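{- Let $\mathbf P=(P,\le,0,1)$ be a complemented poset and $a\in P$. Then: (i) $a\in(a^+)^+$ and $((a^+)^+)^+=a^+$; (ii) $(x^+,\le)$ is an antichain for every $x\in P$ if and only if $\mathbf P$ does not contain a sublattice isomorphic to $\mathbf N_5$ containing $0$ and $1$; (iii) $(a^+,\le)$ is convex; (iv) if the mapping $x\mapsto(x^+)^+$ from $P$ to $2^P$ is not injective, then $\mathbf P$ does not satisfy the identity $(x^+)^+\approx x$ (i.e. it is not true that $(x^+)^+=\{x\}$ for all $x\in P$).
   Context: A bounded poset $(P,\le,0,1)$ is assumed non-trivial ($0\ne1$). For $a,b\in P$, $b$ is a complement of $a$ (written $a\perp b$) if the supremum $a\vee b$ exists and equals $1$ and the infimum $a\wedge b$ exists and equals $0$. The poset is complemented if every element has at least one complement. For $A\subseteq P$, $A^+=\{x\in P\mid x\perp y\text{ for all }y\in A\}$, and for $a\in P$, $a^+=\{a\}^+$ is the set of all complements of $a$; singletons are identified with their elements. $\mathbf N_5$ is the five-element non-modular lattice $\{0,a,b,c,1\}$ with $0<a<c<1$, $0<b<1$, and $b$ incomparable to $a$ and $c$. "Contains a sublattice isomorphic to $\mathbf N_5$ containing $0$ and $1$" means there is a subset $S\subseteq P$ with $0,1\in S$ such that for all $x,y\in S$ the supremum and infimum of $x,y$ in $\mathbf P$ exist and lie in $S$, and $S$ with these operations is a lattice isomorphic to $\mathbf N_5$. A subset $C$ is convex if $x,z\in C$, $y\in P$, $x\le y\le z$ imply $y\in C$. -}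

module Defs where

open import Level using (Level; _⊔_; suc)
open import Data.Product using (_×_; Σ; ∃; ∃-syntax)
open import Relation.Nullary using (¬_)
open import Relation.Unary using (Pred)
open import Relation.Binary.Bundles using (Poset)
open import Relation.Binary.PropositionalEquality using (_≡_)

record BoundedPoset (c ℓ₁ ℓ₂ : Level) : Set (suc (c ⊔ ℓ₁ ⊔ ℓ₂)) where
  field
    poset      : Poset c ℓ₁ ℓ₂
  open Poset poset public
  field
    𝟘          : Carrier
    𝟙          : Carrier
    𝟘-least    : ∀ x → 𝟘 ≤ x
    𝟙-greatest : ∀ x → x ≤ 𝟙
    nontrivial : ¬ (𝟘 ≈ 𝟙)

-- The five-element lattice N5: 0 < a < c < 1, 0 < b < 1, b ∥ a, c.
data N5 : Set where
  n0 na nb nc n1 : N5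

_∨₅_ : N5 → N5 → N5
n0 ∨₅ y  = y
n1 ∨₅ y  = n1
x  ∨₅ n0 = x
x  ∨₅ n1 = n1
na ∨₅ na = na
na ∨₅ nc = nc
nc ∨₅ na = nc
nc ∨₅ nc = nc
nb ∨₅ nb = nb
na ∨₅ nb = n1
nb ∨₅ na = n1
nc ∨₅ nb = n1
nb ∨₅ nc = n1

_∧₅_ : N5 → N5 → N5
n0 ∧₅ y  = n0
n1 ∧₅ y  = y
x  ∧₅ n0 = n0
x  ∧₅ n1 = x
na ∧₅ na = na
na ∧₅ nc = na
nc ∧₅ na = na
nc ∧₅ nc = nc
nb ∧₅ nb = nb
na ∧₅ nb = n0
nb ∧₅ na = n0
nc ∧₅ nb = n0
nb ∧₅ nc = n0

module Ops {c ℓ₁ ℓ₂ : Level} (B : BoundedPoset c ℓ₁ ℓ₂) where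
  open BoundedPoset B

  IsSup : Carrier → Carrier → Carrier → Set (c ⊔ ℓ₂)
  IsSup x y s = x ≤ s × y ≤ s × (∀ z → x ≤ z → y ≤ z → s ≤ z)

  IsInf : Carrier → Carrier → Carrier → Set (c ⊔ ℓ₂)
  IsInf x y i = i ≤ x × i ≤ y × (∀ z → z ≤ x → z ≤ y → z ≤ i)

  _⊥ᶜ_ : Carrier → Carrier → Set (c ⊔ ℓ₂)
  a ⊥ᶜ b = IsSup a b 𝟙 × IsInf a b 𝟘

  Complemented : Set (c ⊔ ℓ₂)
  Complemented = ∀ a → ∃[ b ] (a ⊥ᶜ b)

  _⁺ : ∀ {ℓ} → Pred Carrier ℓ → Pred Carrier (c ⊔ ℓ₂ ⊔ ℓ)
  (A ⁺) x = ∀ y → A y → x ⊥ᶜ y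

  ｛_｝ : Carrier → Pred Carrier ℓ₁
  ｛ a ｝ y = y ≈ a

  _⁺ₑ : Carrier → Pred Carrier (c ⊔ ℓ₁ ⊔ ℓ₂)
  a ⁺ₑ = ｛ a ｝ ⁺

  _<_ : Carrier → Carrier → Set (ℓ₁ ⊔ ℓ₂)
  x < y = x ≤ y × ¬ (x ≈ y)

  Antichain : ∀ {ℓ} → Pred Carrier ℓ → Set (c ⊔ ℓ₁ ⊔ ℓ₂ ⊔ ℓ)
  Antichain A = ∀ x y → A x → A y → ¬ (x < y)

  Convex : ∀ {ℓ} → Pred Carrier ℓ → Set (c ⊔ ℓ₂ ⊔ ℓ)
  Convex A = ∀ x y z → A x → A z → x ≤ y → y ≤ z → A y

  -- P contains a sublattice S isomorphic to N5 with 0, 1 ∈ S: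
  -- an injective f : N5 → P (S = image of f) such that f(u ∨ v) is the
  -- supremum in P of f u, f v and f(u ∧ v) their infimum, and 0, 1 ∈ S.
  ContainsN5 : Set (c ⊔ ℓ₁ ⊔ ℓ₂)
  ContainsN5 = Σ (N5 → Carrier) λ f →
      (∀ u v → f u ≈ f v → u ≡ v)
    × (∀ u v → IsSup (f u) (f v) (f (u ∨₅ v)))
    × (∀ u v → IsInf (f u) (f v) (f (u ∧₅ v)))
    × (∃[ u ] (f u ≈ 𝟘))
    × (∃[ u ] (f u ≈ 𝟙))

-- Everything follows from the symmetry of ⊥ᶜ and the fact that a supremum 𝟙
-- (an infimum 𝟘) persists when one argument moves up (down). Symmetry gives
-- A ⊆ A⁺⁺ and, with antitonicity of ⁺, A⁺⁺⁺ = A⁺; persistence gives convexity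
-- of A⁺. Two comparable complements y < z of x span, together with 0 and 1, a
-- copy of N5 (0 < y < z < 1 and x), and conversely a, c in such a copy are
-- comparable complements of b. If x⁺⁺ = {x} for all x, then x ∈ x⁺⁺ = y⁺⁺ = {y}
-- forces x = y.
module Submission where

open import Defs
open import Level using (Level; _⊔_)
open import Data.Product using (_×_; _,_; proj₁; proj₂; ∃; ∃₂)
open import Data.Empty using (⊥-elim)
open import Relation.Nullary using (¬_)
open import Relation.Nullary.Negation using (contraposition)
open import Relation.Unary using (Pred; _⊆_; _≐_)
open import Function.Bundles using (_⇔_; mk⇔; Equivalence)
open import Relation.Binary.PropositionalEquality using (_≡_; refl)

module Complements {c ℓ₁ ℓ₂ : Level} (B : BoundedPoset c ℓ₁ ℓ₂) where
  open BoundedPoset B renaming (refl to ≤-refl; trans to ≤-trans)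
  open Ops B

  ≈⇒≥ : ∀ {x y} → x ≈ y → y ≤ x
  ≈⇒≥ e = reflexive (Eq.sym e)

  ≉-sym : ∀ {p q} → ¬ (p ≈ q) → ¬ (q ≈ p)
  ≉-sym p≉q q≈p = p≉q (Eq.sym q≈p)

  ≤𝟘⇒≈𝟘 : ∀ {x} → x ≤ 𝟘 → x ≈ 𝟘
  ≤𝟘⇒≈𝟘 p = antisym p (𝟘-least _)

  𝟙≤⇒≈𝟙 : ∀ {x} → 𝟙 ≤ x → x ≈ 𝟙
  𝟙≤⇒≈𝟙 p = antisym (𝟙-greatest _) p

  IsSup-comm : ∀ {x y s} → IsSup x y s → IsSup y x s
  IsSup-comm (x≤s , y≤s , least) = y≤s , x≤s , λ z y≤z x≤z → least z x≤z y≤z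

  IsInf-comm : ∀ {x y i} → IsInf x y i → IsInf y x i
  IsInf-comm (i≤x , i≤y , greatest) = i≤y , i≤x , λ z z≤y z≤x → greatest z z≤x z≤y

  IsSup-of-≤ : ∀ {x y} → x ≤ y → IsSup x y y
  IsSup-of-≤ x≤y = x≤y , ≤-refl , λ _ _ y≤z → y≤z

  IsSup-of-≥ : ∀ {x y} → y ≤ x → IsSup x y x
  IsSup-of-≥ y≤x = IsSup-comm (IsSup-of-≤ y≤x)

  IsInf-of-≤ : ∀ {x y} → x ≤ y → IsInf x y x
  IsInf-of-≤ x≤y = ≤-refl , x≤y , λ _ z≤x _ → z≤x

  IsInf-of-≥ : ∀ {x y} → y ≤ x → IsInf x y y
  IsInf-of-≥ y≤x = IsInf-comm (IsInf-of-≤ y≤x)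

  IsSup-resp-≈ : ∀ {x y s s′} → s ≈ s′ → IsSup x y s → IsSup x y s′
  IsSup-resp-≈ e (x≤s , y≤s , least) =
    ≤-trans x≤s (reflexive e) , ≤-trans y≤s (reflexive e) ,
    λ z x≤z y≤z → ≤-trans (≈⇒≥ e) (least z x≤z y≤z)

  IsInf-resp-≈ : ∀ {x y i i′} → i ≈ i′ → IsInf x y i → IsInf x y i′
  IsInf-resp-≈ e (i≤x , i≤y , greatest) =
    ≤-trans (≈⇒≥ e) i≤x , ≤-trans (≈⇒≥ e) i≤y ,
    λ z z≤x z≤y → ≤-trans (greatest z z≤x z≤y) (reflexive e)

  IsSup𝟙-monoˡ : ∀ {x y w} → x ≤ y → IsSup x w 𝟙 → IsSup y w 𝟙
  IsSup𝟙-monoˡ x≤y (_ , _ , least) =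
    𝟙-greatest _ , 𝟙-greatest _ , λ z y≤z w≤z → least z (≤-trans x≤y y≤z) w≤z

  IsInf𝟘-antimonoˡ : ∀ {x y w} → x ≤ y → IsInf y w 𝟘 → IsInf x w 𝟘
  IsInf𝟘-antimonoˡ x≤y (_ , _ , greatest) =
    𝟘-least _ , 𝟘-least _ , λ z z≤x z≤w → greatest z (≤-trans z≤x x≤y) z≤w

  ⊥ᶜ-sym : ∀ {a b} → a ⊥ᶜ b → b ⊥ᶜ a
  ⊥ᶜ-sym (sup , inf) = IsSup-comm sup , IsInf-comm inf

  ⊥ᶜ-respʳ-≈ : ∀ {a b b′} → b ≈ b′ → a ⊥ᶜ b → a ⊥ᶜ b′
  ⊥ᶜ-respʳ-≈ e ((a≤𝟙 , _ , least) , (𝟘≤a , _ , greatest)) =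
    (a≤𝟙 , 𝟙-greatest _ , λ z a≤z b′≤z → least z a≤z (≤-trans (reflexive e) b′≤z)) ,
    (𝟘≤a , 𝟘-least _ , λ z z≤a z≤b′ → greatest z z≤a (≤-trans z≤b′ (≈⇒≥ e)))

  ⊥ᶜ⇒≉ : ∀ {a b} → a ⊥ᶜ b → ¬ (a ≈ b)
  ⊥ᶜ⇒≉ {a} {b} ((_ , _ , least) , (_ , _ , greatest)) a≈b =
    nontrivial (antisym (𝟘-least _)
      (≤-trans (least b (reflexive a≈b) ≤-refl) (greatest b (≈⇒≥ a≈b) ≤-refl)))

  complement-of-𝟘 : ∀ {a b} → a ⊥ᶜ b → a ≈ 𝟘 → b ≈ 𝟙
  complement-of-𝟘 ((_ , _ , least) , _) a≈𝟘 =
    𝟙≤⇒≈𝟙 (least _ (≤-trans (reflexive a≈𝟘) (𝟘-least _)) ≤-refl)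

  complement-of-𝟙 : ∀ {a b} → a ⊥ᶜ b → a ≈ 𝟙 → b ≈ 𝟘
  complement-of-𝟙 (_ , (_ , _ , greatest)) a≈𝟙 =
    ≤𝟘⇒≈𝟘 (greatest _ (≤-trans (𝟙-greatest _) (≈⇒≥ a≈𝟙)) ≤-refl)

  ⊥ᶜ⇒∈⁺ₑ : ∀ {x a} → x ⊥ᶜ a → (a ⁺ₑ) x
  ⊥ᶜ⇒∈⁺ₑ x⊥a _ y≈a = ⊥ᶜ-respʳ-≈ (Eq.sym y≈a) x⊥a

  ∈⁺ₑ⇒⊥ᶜ : ∀ {x a} → (a ⁺ₑ) x → x ⊥ᶜ a
  ∈⁺ₑ⇒⊥ᶜ x∈a⁺ = x∈a⁺ _ Eq.refl

  ⁺-antitone : ∀ {ℓ ℓ′} {A : Pred Carrier ℓ} {A′ : Pred Carrier ℓ′} → A ⊆ A′ → A′ ⁺ ⊆ A ⁺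
  ⁺-antitone A⊆A′ x∈A′⁺ y y∈A = x∈A′⁺ y (A⊆A′ y∈A)

  ⊆⁺⁺ : ∀ {ℓ} {A : Pred Carrier ℓ} → A ⊆ (A ⁺) ⁺
  ⊆⁺⁺ x∈A y y∈A⁺ = ⊥ᶜ-sym (y∈A⁺ _ x∈A)

  ⁺⁺⁺≐⁺ : ∀ {ℓ} (A : Pred Carrier ℓ) → ((A ⁺) ⁺) ⁺ ≐ A ⁺
  ⁺⁺⁺≐⁺ A = ⁺-antitone (⊆⁺⁺ {A = A}) , ⊆⁺⁺

  ⁺-convex : ∀ {ℓ} (A : Pred Carrier ℓ) → Convex (A ⁺)
  ⁺-convex A x y z x∈A⁺ z∈A⁺ x≤y y≤z w w∈A =
    IsSup𝟙-monoˡ x≤y (proj₁ (x∈A⁺ w w∈A)) , IsInf𝟘-antimonoˡ y≤z (proj₂ (z∈A⁺ w w∈A))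

  ⁺⁺≐｛｝⇒⁺⁺-injective : (∀ x → ((x ⁺ₑ) ⁺) ≐ ｛ x ｝) →
                         ∀ x y → ((x ⁺ₑ) ⁺) ≐ ((y ⁺ₑ) ⁺) → x ≈ y
  ⁺⁺≐｛｝⇒⁺⁺-injective ⁺⁺≐｛｝ x y (x⁺⁺⊆y⁺⁺ , _) =
    proj₁ (⁺⁺≐｛｝ y) (x⁺⁺⊆y⁺⁺ (⊆⁺⁺ {A = ｛ x ｝} Eq.refl))

  ComparableComplements : Set (c ⊔ ℓ₁ ⊔ ℓ₂)
  ComparableComplements = ∃ λ x → ∃₂ λ y z → y ⊥ᶜ x × z ⊥ᶜ x × y < z

  Antichain-complements⇔¬ComparableComplements :
    (∀ x → Antichain (x ⁺ₑ)) ⇔ (¬ ComparableComplements)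
  Antichain-complements⇔¬ComparableComplements = mk⇔
    (λ antichain (x , y , z , y⊥x , z⊥x , y<z) →
      antichain x y z (⊥ᶜ⇒∈⁺ₑ y⊥x) (⊥ᶜ⇒∈⁺ₑ z⊥x) y<z)
    (λ ¬comparable x y z y∈x⁺ z∈x⁺ y<z →
      ¬comparable (x , y , z , ∈⁺ₑ⇒⊥ᶜ y∈x⁺ , ∈⁺ₑ⇒⊥ᶜ z∈x⁺ , y<z))

  ContainsN5⇒ComparableComplements : ContainsN5 → ComparableComplements
  ContainsN5⇒ComparableComplements (f , injective , sup , inf , (u , fu≈𝟘) , (v , fv≈𝟙)) =
    f nb , f na , f nc ,
    complement-of-fnb (sup na nb) (inf na nb) , complement-of-fnb (sup nc nb) (inf nc nb) ,
    (proj₁ (sup na nc) , λ fa≈fc → na≢nc (injective na nc fa≈fc))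
    where
      f𝟙≈𝟙 : f n1 ≈ 𝟙
      f𝟙≈𝟙 = 𝟙≤⇒≈𝟙 (≤-trans (≈⇒≥ fv≈𝟙) (proj₁ (proj₂ (sup n1 v))))

      f𝟘≈𝟘 : f n0 ≈ 𝟘
      f𝟘≈𝟘 = ≤𝟘⇒≈𝟘 (≤-trans (proj₁ (proj₂ (inf n0 u))) (reflexive fu≈𝟘))

      complement-of-fnb : ∀ {w} → IsSup (f w) (f nb) (f n1) → IsInf (f w) (f nb) (f n0) →
                          f w ⊥ᶜ f nb
      complement-of-fnb sup₁ inf₀ = IsSup-resp-≈ f𝟙≈𝟙 sup₁ , IsInf-resp-≈ f𝟘≈𝟘 inf₀

      na≢nc : ¬ (na ≡ nc)
      na≢nc ()

  module N5-of-comparable-complements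
    {x y z : Carrier} (y⊥x : y ⊥ᶜ x) (z⊥x : z ⊥ᶜ x) (y≤z : y ≤ z) (y≉z : ¬ (y ≈ z)) where

    f : N5 → Carrier
    f n0 = 𝟘
    f na = y
    f nb = x
    f nc = z
    f n1 = 𝟙

    sup : ∀ u v → IsSup (f u) (f v) (f (u ∨₅ v))
    sup n0 v  = IsSup-of-≤ (𝟘-least _)
    sup n1 v  = IsSup-of-≥ (𝟙-greatest _)
    sup na n0 = IsSup-of-≥ (𝟘-least _)
    sup nb n0 = IsSup-of-≥ (𝟘-least _)
    sup nc n0 = IsSup-of-≥ (𝟘-least _)
    sup na n1 = IsSup-of-≤ (𝟙-greatest _)
    sup nb n1 = IsSup-of-≤ (𝟙-greatest _)
    sup nc n1 = IsSup-of-≤ (𝟙-greatest _)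
    sup na na = IsSup-of-≤ ≤-refl
    sup nb nb = IsSup-of-≤ ≤-refl
    sup nc nc = IsSup-of-≤ ≤-refl
    sup na nc = IsSup-of-≤ y≤z
    sup nc na = IsSup-of-≥ y≤z
    sup na nb = proj₁ y⊥x
    sup nb na = IsSup-comm (proj₁ y⊥x)
    sup nc nb = proj₁ z⊥x
    sup nb nc = IsSup-comm (proj₁ z⊥x)

    inf : ∀ u v → IsInf (f u) (f v) (f (u ∧₅ v))
    inf n0 v  = IsInf-of-≤ (𝟘-least _)
    inf n1 v  = IsInf-of-≥ (𝟙-greatest _)
    inf na n0 = IsInf-of-≥ (𝟘-least _)
    inf nb n0 = IsInf-of-≥ (𝟘-least _)
    inf nc n0 = IsInf-of-≥ (𝟘-least _)
    inf na n1 = IsInf-of-≤ (𝟙-greatest _)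
    inf nb n1 = IsInf-of-≤ (𝟙-greatest _)
    inf nc n1 = IsInf-of-≤ (𝟙-greatest _)
    inf na na = IsInf-of-≤ ≤-refl
    inf nb nb = IsInf-of-≤ ≤-refl
    inf nc nc = IsInf-of-≤ ≤-refl
    inf na nc = IsInf-of-≤ y≤z
    inf nc na = IsInf-of-≥ y≤z
    inf na nb = proj₂ y⊥x
    inf nb na = IsInf-comm (proj₂ y⊥x)
    inf nc nb = proj₂ z⊥x
    inf nb nc = IsInf-comm (proj₂ z⊥x)

    x≉𝟘 : ¬ (x ≈ 𝟘)
    x≉𝟘 x≈𝟘 = y≉z (Eq.trans (≈𝟙 y⊥x) (Eq.sym (≈𝟙 z⊥x)))
      where
        ≈𝟙 : ∀ {w} → w ⊥ᶜ x → w ≈ 𝟙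
        ≈𝟙 w⊥x = complement-of-𝟘 (⊥ᶜ-sym w⊥x) x≈𝟘

    x≉𝟙 : ¬ (x ≈ 𝟙)
    x≉𝟙 x≈𝟙 = y≉z (Eq.trans (≈𝟘 y⊥x) (Eq.sym (≈𝟘 z⊥x)))
      where
        ≈𝟘 : ∀ {w} → w ⊥ᶜ x → w ≈ 𝟘
        ≈𝟘 w⊥x = complement-of-𝟙 (⊥ᶜ-sym w⊥x) x≈𝟙

    ⊥x-≉𝟘 : ∀ {w} → w ⊥ᶜ x → ¬ (w ≈ 𝟘)
    ⊥x-≉𝟘 w⊥x w≈𝟘 = x≉𝟙 (complement-of-𝟘 w⊥x w≈𝟘)

    ⊥x-≉𝟙 : ∀ {w} → w ⊥ᶜ x → ¬ (w ≈ 𝟙)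
    ⊥x-≉𝟙 w⊥x w≈𝟙 = x≉𝟘 (complement-of-𝟙 w⊥x w≈𝟙)

    injective : ∀ u v → f u ≈ f v → u ≡ v
    injective n0 n0 _ = refl
    injective na na _ = refl
    injective nb nb _ = refl
    injective nc nc _ = refl
    injective n1 n1 _ = refl
    injective n0 n1 e = ⊥-elim (nontrivial e)
    injective n1 n0 e = ⊥-elim (≉-sym nontrivial e)
    injective n0 na e = ⊥-elim (≉-sym (⊥x-≉𝟘 y⊥x) e)
    injective na n0 e = ⊥-elim (⊥x-≉𝟘 y⊥x e)
    injective n0 nb e = ⊥-elim (≉-sym x≉𝟘 e)
    injective nb n0 e = ⊥-elim (x≉𝟘 e)
    injective n0 nc e = ⊥-elim (≉-sym (⊥x-≉𝟘 z⊥x) e)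
    injective nc n0 e = ⊥-elim (⊥x-≉𝟘 z⊥x e)
    injective n1 na e = ⊥-elim (≉-sym (⊥x-≉𝟙 y⊥x) e)
    injective na n1 e = ⊥-elim (⊥x-≉𝟙 y⊥x e)
    injective n1 nb e = ⊥-elim (≉-sym x≉𝟙 e)
    injective nb n1 e = ⊥-elim (x≉𝟙 e)
    injective n1 nc e = ⊥-elim (≉-sym (⊥x-≉𝟙 z⊥x) e)
    injective nc n1 e = ⊥-elim (⊥x-≉𝟙 z⊥x e)
    injective na nb e = ⊥-elim (⊥ᶜ⇒≉ y⊥x e)
    injective nb na e = ⊥-elim (≉-sym (⊥ᶜ⇒≉ y⊥x) e)
    injective nc nb e = ⊥-elim (⊥ᶜ⇒≉ z⊥x e)
    injective nb nc e = ⊥-elim (≉-sym (⊥ᶜ⇒≉ z⊥x) e)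
    injective na nc e = ⊥-elim (y≉z e)
    injective nc na e = ⊥-elim (≉-sym y≉z e)

    containsN5 : ContainsN5
    containsN5 = f , injective , sup , inf , (n0 , Eq.refl) , (n1 , Eq.refl)

  ComparableComplements⇒ContainsN5 : ComparableComplements → ContainsN5
  ComparableComplements⇒ContainsN5 (_ , _ , _ , y⊥x , z⊥x , y≤z , y≉z) =
    N5-of-comparable-complements.containsN5 y⊥x z⊥x y≤z y≉z

proposition3p2 : ∀ {c ℓ₁ ℓ₂ : Level} (B : BoundedPoset c ℓ₁ ℓ₂) →
    let open BoundedPoset B
        open Ops B
    in Complemented → (a : Carrier) →
      ((((a ⁺ₑ) ⁺) a) × ((((a ⁺ₑ) ⁺) ⁺) ≐ (a ⁺ₑ)))
      × ((∀ x → Antichain (x ⁺ₑ)) ⇔ (¬ ContainsN5))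
      × Convex (a ⁺ₑ)
      × (¬ (∀ x y → ((x ⁺ₑ) ⁺) ≐ ((y ⁺ₑ) ⁺) → x ≈ y)
           → ¬ (∀ x → ((x ⁺ₑ) ⁺) ≐ ｛ x ｝))
proposition3p2 B _ a =
  (⊆⁺⁺ {A = ｛ a ｝} Eq.refl , ⁺⁺⁺≐⁺ ｛ a ｝) ,
  mk⇔ (λ antichain → contraposition ContainsN5⇒ComparableComplements (to antichain))
      (λ ¬N5 → from (contraposition ComparableComplements⇒ContainsN5 ¬N5)) ,
  ⁺-convex ｛ a ｝ ,
  contraposition ⁺⁺≐｛｝⇒⁺⁺-injective
  where
    open BoundedPoset B using (module Eq)
    open Ops B using (｛_｝)
    open Complements B
    open Equivalence Antichain-complements⇔¬ComparableComplements
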